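{- Let $k\geq 2$ and $n\geq 1$ be integers, let $t_1,\dots,t_k$ be indeterminates, and work in the field $\mathbb{C}(t_1,\dots,t_k)$ of rational functions. Set $t_0=1$ and let $i=\sqrt{ -1}$. Let $H_{k,n}=(h_{rs})_{1\le r,s\le n}$ be the $n\times n$ lower Hessenberg matrix with $$h_{rs}=\begin{cases} i^{\,r-s}\,\dfrac{t_{r-s+1}}{t_2^{\,r-s}} & \text{if } -1\leq r-s<k,\\[2mm] 0 & \text{otherwise.}\end{cases}$$ (Thus the superdiagonal entries are $-i t_2$, the diagonal entries are $t_1$, the subdiagonal entries are $i$, and the entries with $r-s=d$, $2\le d\le k-1$, are $i^{d}t_{d+1}/t_2^{d}$.) Then $$\operatorname{per}(H_{k,n})=F_{k,n+1}(t),$$ where $\operatorname{per}(A)=\sum_{\sigma\in S_n}\prod_{r=1}^n a_{r,\sigma(r)}$ denotes the permanent.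
   Context: The generalized Fibonacci polynomials $F_{k,n}(t)$, $t=(t_1,\dots,t_k)$, are defined by $F_{k,n}(t)=0$ for $n<1$, $F_{k,1}(t)=1$, $F_{k,2}(t)=t_1$, and $F_{k,n+1}(t)=t_1F_{k,n}(t)+t_2F_{k,n-1}(t)+\cdots+t_kF_{k,n-k+1}(t)$ for $n\ge 1$. -}

module Defs where

open import Level using (Level)
open import Algebra.Bundles using (CommutativeRing)
open import Data.Nat as ℕ using (ℕ; zero; suc; _≤?_; _<?_)
open import Data.Fin using (Fin; zero; suc; toℕ; fromℕ<)
open import Data.Fin.Properties using (all?; _≟_)
open import Data.List using (List; []; _∷_; map; concatMap; filter; foldr)
open import Relation.Binary.PropositionalEquality using (_≡_)
open import Relation.Nullary using (Dec; yes; no)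
open import Relation.Nullary.Decidable using (_→-dec_)

Inj : ∀ {n} → (Fin n → Fin n) → Set
Inj σ = ∀ x y → σ x ≡ σ y → x ≡ y

inj? : ∀ {n} (σ : Fin n → Fin n) → Dec (Inj σ)
inj? σ = all? (λ x → all? (λ y → (σ x ≟ σ y) →-dec (x ≟ y)))

allFuns : (n m : ℕ) → List (Fin n → Fin m)
allFuns zero    m = (λ ()) ∷ []
allFuns (suc n) m =
  concatMap (λ j → map (λ f → λ { zero → j ; (suc x) → f x }) (allFuns n m))
            (Data.List.allFin m)

perms : (n : ℕ) → List (Fin n → Fin n)
perms n = filter inj? (allFuns n n)

module WithRing {c ℓ : Level} (R : CommutativeRing c ℓ) where
  open CommutativeRing R using (Carrier; _+_; _*_; -_; 0#; 1#)

  sumL : List Carrier → Carrier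
  sumL = foldr _+_ 0#

  prodFin : ∀ n → (Fin n → Carrier) → Carrier
  prodFin zero    f = 1#
  prodFin (suc n) f = f zero * prodFin n (λ r → f (suc r))

  sumFin : ∀ n → (Fin n → Carrier) → Carrier
  sumFin zero    f = 0#
  sumFin (suc n) f = f zero + sumFin n (λ r → f (suc r))

  per : ∀ n → (Fin n → Fin n → Carrier) → Carrier
  per n A = sumL (map (λ σ → prodFin n (λ r → A r (σ r))) (perms n))

  pow : Carrier → ℕ → Carrier
  pow x zero    = 1#
  pow x (suc m) = x * pow x m

  -- t_j for j : ℕ, from t = (t_1,…,t_k); t_0 = 1, t_j = 0 for j > k
  tt : ∀ k → (Fin k → Carrier) → ℕ → Carrier
  tt k t zero = 1#
  tt k t (suc j) with j ℕ.<? k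
  ... | yes p = t (fromℕ< p)
  ... | no _  = 0#

  -- list lookup with default 0 (F_{k,m} = 0 for m < 1)
  at : List Carrier → ℕ → Carrier
  at []       _       = 0#
  at (x ∷ xs) zero    = x
  at (x ∷ xs) (suc j) = at xs j

  -- Fs k t m = [F_{k,m}, F_{k,m-1}, …, F_{k,0}]
  Fs : ∀ k → (Fin k → Carrier) → ℕ → List Carrier
  Fs k t zero          = 0# ∷ []
  Fs k t (suc zero)    = 1# ∷ 0# ∷ []
  Fs k t (suc (suc m)) =
    let prev = Fs k t (suc m)
    in sumFin k (λ j → t j * at prev (toℕ j)) ∷ prev
    -- F_{k,m+2} = Σ_{j=1}^{k} t_j F_{k,m+2-j}

  F : ∀ k → (Fin k → Carrier) → ℕ → Carrier
  F k t m = at (Fs k t m) 0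

  -- the matrix H_{k,n} (0-indexed rows r and columns s; r - s as in the paper),
  -- with i an element of square -1 and u = t_2⁻¹
  H : ∀ k → (Fin k → Carrier) → (i u : Carrier) → ∀ n → Fin n → Fin n → Carrier
  H k t i u n r s with toℕ s ℕ.≟ suc (toℕ r)
  ... | yes _ = (- i) * tt k t 2                     -- r - s = -1 : i^{-1} t_0 / t_2^{-1}
  ... | no _ with toℕ s ℕ.≤? toℕ r
  ...   | no _ = 0#
  ...   | yes _ with (toℕ r ℕ.∸ toℕ s) ℕ.<? k
  ...     | yes _ = pow i (toℕ r ℕ.∸ toℕ s) * tt k t (suc (toℕ r ℕ.∸ toℕ s))
                      * pow u (toℕ r ℕ.∸ toℕ s)
  ...     | no _  = 0#

{-# OPTIONS --safe #-}
-- H_{k,n} is a lower Hessenberg Toeplitz matrix: superdiagonal x = −i t₂ and entries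
-- a_d = i^d t_{d+1} t₂^{−d} on the d-th subdiagonal. Expanding the permanent along the first
-- row, where only the entries a₀ and x are nonzero, and carrying the first column along in the
-- second minor, gives per H_{m+1} = Σ_{r ≤ m} x^r a_r per H_{m−r}. Since x^r a_r = t_{r+1},
-- this is the recurrence of F_{k,m+2}, and per H_0 = 1 = F_{k,1}.
-- The Laplace expansion is obtained by writing the permanent as a sum over all maps
-- σ : Fin n → Fin n weighted by a 0/1 indicator of injectivity.
module Submission where

open import Defs
open import Level using (Level)
open import Algebra.Bundles using (CommutativeRing)
open import Data.Nat using (ℕ; _≤_; suc; zero; _∸_; _<_; z≤n; s≤s)
import Data.Nat as ℕ
import Data.Nat.Properties as ℕ
open import Data.Fin using (Fin; zero; suc; toℕ; punchIn)
import Data.Fin.Properties as Fin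
open import Data.Vec.Functional using (_∷_)
import Data.List as List
open import Data.List using (List; map; concatMap; filter; tabulate; allFin; _++_)
import Data.List.Properties as List
open import Data.Product using (_,_)
open import Function using (_∘_; Injective)
open import Relation.Binary.Core using (_Preserves_⟶_)
open import Relation.Binary.PropositionalEquality as ≡ using (_≡_; _≢_; _≗_)
open import Relation.Nullary using (¬_; yes; no; contradiction)

∷-congʳ : ∀ {A : Set} {n} (x : A) {f g : Fin n → A} → f ≗ g → (x ∷ f) ≗ (x ∷ g)
∷-congʳ x f≗g zero    = ≡.refl
∷-congʳ x f≗g (suc i) = f≗g i

∘-∷ : ∀ {A B : Set} {n} (h : A → B) x (f : Fin n → A) → (h x ∷ h ∘ f) ≗ h ∘ (x ∷ f)
∘-∷ h x f zero    = ≡.refl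
∘-∷ h x f (suc i) = ≡.refl

module Sums {c ℓ : Level} (R : CommutativeRing c ℓ) where
  open CommutativeRing R hiding (zero)
  open WithRing R
  open import Algebra.Properties.Semiring.Sum semiring public
    using (sum; sum-syntax; sum-cong-≋; *-distribˡ-sum; sum-remove; sum-replicate-zero)

  ∑-zero : ∀ n {f : Fin n → Carrier} → (∀ j → f j ≈ 0#) → sum f ≈ 0#
  ∑-zero n f≈0 = trans (sum-cong-≋ f≈0) (sum-replicate-zero n)

  ∑ℕ : ℕ → (ℕ → Carrier) → Carrier
  ∑ℕ zero    f = 0#
  ∑ℕ (suc N) f = f 0 + ∑ℕ N (f ∘ suc)

  sumFin-toℕ : ∀ N {f : Fin N → Carrier} (g : ℕ → Carrier) → (∀ j → f j ≈ g (toℕ j)) → sumFin N f ≈ ∑ℕ N g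
  sumFin-toℕ zero    g f≈g = refl
  sumFin-toℕ (suc N) g f≈g = +-cong (f≈g zero) (sumFin-toℕ N (g ∘ suc) (f≈g ∘ suc))

  ∑ℕ-cong : ∀ N {f g : ℕ → Carrier} → (∀ r → r < N → f r ≈ g r) → ∑ℕ N f ≈ ∑ℕ N g
  ∑ℕ-cong zero    f≈g = refl
  ∑ℕ-cong (suc N) f≈g = +-cong (f≈g 0 (s≤s z≤n)) (∑ℕ-cong N (λ r → f≈g (suc r) ∘ s≤s))

  *-distribˡ-∑ℕ : ∀ N x (f : ℕ → Carrier) → x * ∑ℕ N f ≈ ∑ℕ N (λ r → x * f r)
  *-distribˡ-∑ℕ zero    x f = zeroʳ x
  *-distribˡ-∑ℕ (suc N) x f = trans (distribˡ x _ _) (+-congˡ (*-distribˡ-∑ℕ N x (f ∘ suc)))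

  ∑ℕ-vanishing : ∀ {M N} {f : ℕ → Carrier} → M ≤ N → (∀ r → M ≤ r → f r ≈ 0#) → ∑ℕ N f ≈ ∑ℕ M f
  ∑ℕ-vanishing {N = zero}  z≤n       f≈0 = refl
  ∑ℕ-vanishing {N = suc N} z≤n       f≈0 =
    trans (+-cong (f≈0 0 z≤n) (∑ℕ-vanishing {N = N} z≤n (λ r _ → f≈0 (suc r) z≤n))) (+-identityˡ 0#)
  ∑ℕ-vanishing             (s≤s M≤N) f≈0 = +-congˡ (∑ℕ-vanishing M≤N (λ r → f≈0 (suc r) ∘ s≤s))

  sumL-map-cong : ∀ {A : Set} {f g : A → Carrier} → (∀ x → f x ≈ g x) → ∀ xs → sumL (map f xs) ≈ sumL (map g xs)
  sumL-map-cong f≈g List.[]       = refl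
  sumL-map-cong f≈g (x List.∷ xs) = +-cong (f≈g x) (sumL-map-cong f≈g xs)

  sumL-++ : ∀ xs ys → sumL (xs ++ ys) ≈ sumL xs + sumL ys
  sumL-++ List.[]       ys = sym (+-identityˡ _)
  sumL-++ (x List.∷ xs) ys = trans (+-congˡ (sumL-++ xs ys)) (sym (+-assoc _ _ _))

  sumL-concatMap : ∀ {A : Set} (h : A → List Carrier) xs → sumL (concatMap h xs) ≈ sumL (map (sumL ∘ h) xs)
  sumL-concatMap h List.[]       = refl
  sumL-concatMap h (x List.∷ xs) = trans (sumL-++ (h x) _) (+-congˡ (sumL-concatMap h xs))

  sumL-map-tabulate : ∀ {A : Set} {n} (h : A → Carrier) (f : Fin n → A) → sumL (map h (tabulate f)) ≡ sum (h ∘ f)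
  sumL-map-tabulate {n = zero}  h f = ≡.refl
  sumL-map-tabulate {n = suc n} h f = ≡.cong (h (f zero) +_) (sumL-map-tabulate h (f ∘ suc))

  sumFuns : ∀ n m → ((Fin n → Fin m) → Carrier) → Carrier
  sumFuns zero    m g = g (λ ())
  sumFuns (suc n) m g = ∑[ j < m ] sumFuns n m (λ f → g (j ∷ f))

  sumFuns-cong : ∀ n m {g h : (Fin n → Fin m) → Carrier} → (∀ f → g f ≈ h f) → sumFuns n m g ≈ sumFuns n m h
  sumFuns-cong zero    m g≈h = g≈h _
  sumFuns-cong (suc n) m g≈h = sum-cong-≋ (λ j → sumFuns-cong n m (λ f → g≈h (j ∷ f)))

  *-distribˡ-sumFuns : ∀ n m x (g : (Fin n → Fin m) → Carrier) → x * sumFuns n m g ≈ sumFuns n m (λ f → x * g f)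
  *-distribˡ-sumFuns zero    m x g = refl
  *-distribˡ-sumFuns (suc n) m x g =
    trans (*-distribˡ-sum x (λ j → sumFuns n m (λ f → g (j ∷ f)))) (sum-cong-≋ (λ j → *-distribˡ-sumFuns n m x (λ f → g (j ∷ f))))

  sumL-allFuns : ∀ n m (g : (Fin n → Fin m) → Carrier) → g Preserves _≗_ ⟶ _≈_ →
                 sumL (map g (allFuns n m)) ≈ sumFuns n m g
  sumL-allFuns zero    m g g-cong = trans (+-identityʳ _) (g-cong (λ ()))
  -- allFuns extends maps by an anonymous pattern lambda, which can only be reached by abstraction
  sumL-allFuns (suc n) m g g-cong =
    expand _ (λ j f → λ { zero → ≡.refl ; (suc x) → ≡.refl })
    where
    open import Relation.Binary.Reasoning.Setoid setoid
    expand : (ext : Fin m → (Fin n → Fin m) → Fin (suc n) → Fin m) → (∀ j f → ext j f ≗ j ∷ f) →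
             sumL (map g (concatMap (λ j → map (ext j) (allFuns n m)) (allFin m))) ≈ sumFuns (suc n) m g
    expand ext ext≗∷ = begin
      sumL (map g (concatMap (λ j → map (ext j) (allFuns n m)) (allFin m)))
        ≡⟨ ≡.cong sumL (List.map-concatMap g _ (allFin m)) ⟩
      sumL (concatMap (λ j → map g (map (ext j) (allFuns n m))) (allFin m))
        ≈⟨ sumL-concatMap _ (allFin m) ⟩
      sumL (map (λ j → sumL (map g (map (ext j) (allFuns n m)))) (allFin m))
        ≡⟨ sumL-map-tabulate {n = m} _ (λ j → j) ⟩
      ∑[ j < m ] sumL (map g (map (ext j) (allFuns n m)))
        ≈⟨ sum-cong-≋ (λ j → trans (reflexive (≡.cong sumL (≡.sym (List.map-∘ (allFuns n m)))))
                                    (sumL-allFuns n m (g ∘ ext j) (λ f≗f' → g-cong (ext-cong j f≗f')))) ⟩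
      ∑[ j < m ] sumFuns n m (g ∘ ext j)
        ≈⟨ sum-cong-≋ (λ j → sumFuns-cong n m (λ f → g-cong (ext≗∷ j f))) ⟩
      sumFuns (suc n) m g ∎
      where
      ext-cong : ∀ j {f f'} → f ≗ f' → ext j f ≗ ext j f'
      ext-cong j {f} {f'} f≗f' x =
        ≡.trans (ext≗∷ j f x) (≡.trans (∷-congʳ j f≗f' x) (≡.sym (ext≗∷ j f' x)))

  recurrence-unique : ∀ (w P Q : ℕ → Carrier) → P 0 ≈ Q 0 →
    (∀ m → P (suc m) ≈ ∑ℕ (suc m) (λ r → w r * P (m ∸ r))) →
    (∀ m → Q (suc m) ≈ ∑ℕ (suc m) (λ r → w r * Q (m ∸ r))) →
    ∀ n → P n ≈ Q n
  recurrence-unique w P Q P₀≈Q₀ recP recQ n = upTo n n ℕ.≤-refl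
    where
    upTo : ∀ n j → j ≤ n → P j ≈ Q j
    upTo n       zero    _         = P₀≈Q₀
    upTo (suc n) (suc j) (s≤s j≤n) =
      trans (recP j) (trans (∑ℕ-cong (suc j) (λ r _ → *-congˡ {w r} (upTo n (j ∸ r) (ℕ.≤-trans (ℕ.m∸n≤m j r) j≤n))))
                            (sym (recQ j)))

module Permanent {c ℓ : Level} (R : CommutativeRing c ℓ) where
  open CommutativeRing R hiding (zero)
  open WithRing R
  open Sums R
  open import Relation.Binary.Reasoning.Setoid setoid
  open import Algebra.Solver.Ring.NaturalCoefficients.Default commutativeSemiring

  prodFin-cong : ∀ n {f g : Fin n → Carrier} → (∀ j → f j ≈ g j) → prodFin n f ≈ prodFin n g
  prodFin-cong zero    f≈g = refl
  prodFin-cong (suc n) f≈g = *-cong (f≈g zero) (prodFin-cong n (f≈g ∘ suc))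

  -- opaque, so that unification never unfolds the `with` on a ≟ b
  opaque
    χ≢ : ∀ {m} → Fin m → Fin m → Carrier
    χ≢ a b with a Fin.≟ b
    ... | yes _ = 0#
    ... | no  _ = 1#

    χ≢-≡ : ∀ {m} {a b : Fin m} → a ≡ b → χ≢ a b ≈ 0#
    χ≢-≡ {a = a} {b} a≡b with a Fin.≟ b
    ... | yes _   = refl
    ... | no  a≢b = contradiction a≡b a≢b

    χ≢-≢ : ∀ {m} {a b : Fin m} → a ≢ b → χ≢ a b ≈ 1#
    χ≢-≢ {a = a} {b} a≢b with a Fin.≟ b
    ... | yes a≡b = contradiction a≡b a≢b
    ... | no  _   = refl

  χ≢-injective : ∀ {m m'} {f : Fin m → Fin m'} → Injective _≡_ _≡_ f → ∀ a b → χ≢ (f a) (f b) ≈ χ≢ a b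
  χ≢-injective {f = f} f-inj a b with a Fin.≟ b
  ... | yes a≡b = trans (χ≢-≡ (≡.cong f a≡b)) (sym (χ≢-≡ a≡b))
  ... | no  a≢b = trans (χ≢-≢ (a≢b ∘ f-inj)) (sym (χ≢-≢ a≢b))

  ∑-χ≢ : ∀ {m} (a : Fin (suc m)) (g : Fin (suc m) → Carrier) →
         ∑[ b < suc m ] (χ≢ a b * g b) ≈ ∑[ j < m ] g (punchIn a j)
  ∑-χ≢ a g = begin
    ∑[ b < _ ] (χ≢ a b * g b)
      ≈⟨ sum-remove {i = a} (λ b → χ≢ a b * g b) ⟩
    χ≢ a a * g a + ∑[ j < _ ] (χ≢ a (punchIn a j) * g (punchIn a j))
      ≈⟨ +-cong (trans (*-congʳ (χ≢-≡ ≡.refl)) (zeroˡ _))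
                (sum-cong-≋ (λ j → trans (*-congʳ (χ≢-≢ (Fin.punchInᵢ≢i a j ∘ ≡.sym))) (*-identityˡ _))) ⟩
    0# + ∑[ j < _ ] g (punchIn a j)
      ≈⟨ +-identityˡ _ ⟩
    ∑[ j < _ ] g (punchIn a j) ∎

  χ∉ : ∀ {n m} → Fin m → (Fin n → Fin m) → Carrier
  χ∉ {n} a ρ = prodFin n (λ x → χ≢ a (ρ x))

  χ-inj : ∀ {n m} → (Fin n → Fin m) → Carrier
  χ-inj {zero}  σ = 1#
  χ-inj {suc n} σ = χ∉ (σ zero) (σ ∘ suc) * χ-inj (σ ∘ suc)

  χ∉-∈ : ∀ {n m} {a : Fin m} (ρ : Fin n → Fin m) x → ρ x ≡ a → χ∉ a ρ ≈ 0#
  χ∉-∈ ρ zero    ρx≡a = trans (*-congʳ (χ≢-≡ (≡.sym ρx≡a))) (zeroˡ _)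
  χ∉-∈ ρ (suc x) ρx≡a = trans (*-congˡ (χ∉-∈ (ρ ∘ suc) x ρx≡a)) (zeroʳ _)

  χ∉-∉ : ∀ {n m} {a : Fin m} (ρ : Fin n → Fin m) → (∀ x → ρ x ≢ a) → χ∉ a ρ ≈ 1#
  χ∉-∉ {zero}  ρ a∉ρ = refl
  χ∉-∉ {suc n} ρ a∉ρ =
    trans (*-cong (χ≢-≢ (a∉ρ zero ∘ ≡.sym)) (χ∉-∉ (ρ ∘ suc) (a∉ρ ∘ suc))) (*-identityˡ 1#)

  χ-inj-injective : ∀ {n m} (σ : Fin n → Fin m) → Injective _≡_ _≡_ σ → χ-inj σ ≈ 1#
  χ-inj-injective {zero}  σ σ-inj = refl
  χ-inj-injective {suc n} σ σ-inj =
    trans (*-cong (χ∉-∉ (σ ∘ suc) (λ x → Fin.0≢1+n ∘ ≡.sym ∘ σ-inj))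
                  (χ-inj-injective (σ ∘ suc) (Fin.suc-injective ∘ σ-inj)))
          (*-identityˡ 1#)

  χ-inj-¬injective : ∀ {n m} (σ : Fin n → Fin m) → ¬ Injective _≡_ _≡_ σ → χ-inj σ ≈ 0#
  χ-inj-¬injective {zero}  σ σ-noninj = contradiction (λ { {()} }) σ-noninj
  χ-inj-¬injective {suc n} σ σ-noninj with Fin.any? (λ x → σ (suc x) Fin.≟ σ zero)
  ... | yes (x , σx≡σ0) = trans (*-congʳ (χ∉-∈ (σ ∘ suc) x σx≡σ0)) (zeroˡ _)
  ... | no  σ0∉σ        = trans (*-congˡ (χ-inj-¬injective (σ ∘ suc) (σ-noninj ∘ extend))) (zeroʳ _)
    where
    extend : Injective _≡_ _≡_ (σ ∘ suc) → Injective _≡_ _≡_ σ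
    extend tail-inj {zero}  {zero}  _ = ≡.refl
    extend tail-inj {zero}  {suc y} e = contradiction (y , ≡.sym e) σ0∉σ
    extend tail-inj {suc x} {zero}  e = contradiction (x , e) σ0∉σ
    extend tail-inj {suc x} {suc y} e = ≡.cong suc (tail-inj e)

  perTerm : ∀ {n m} → (Fin n → Fin m → Carrier) → (Fin n → Fin m) → Carrier
  perTerm {n} A σ = χ-inj σ * prodFin n (λ r → A r (σ r))

  χ-inj-cong : ∀ {n m} {σ σ' : Fin n → Fin m} → σ ≗ σ' → χ-inj σ ≈ χ-inj σ'
  χ-inj-cong {zero}  σ≗σ' = refl
  χ-inj-cong {suc n} σ≗σ' =
    *-cong (prodFin-cong n (λ x → reflexive (≡.cong₂ χ≢ (σ≗σ' zero) (σ≗σ' (suc x)))))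
           (χ-inj-cong (σ≗σ' ∘ suc))

  perTerm-cong : ∀ {n m} (A : Fin n → Fin m → Carrier) → perTerm A Preserves _≗_ ⟶ _≈_
  perTerm-cong {n} A σ≗σ' = *-cong (χ-inj-cong σ≗σ') (prodFin-cong n (λ r → reflexive (≡.cong (A r) (σ≗σ' r))))

  χ-inj-punchIn : ∀ {n m} (a : Fin (suc m)) (τ : Fin n → Fin m) → χ-inj (punchIn a ∘ τ) ≈ χ-inj τ
  χ-inj-punchIn {zero}  a τ = refl
  χ-inj-punchIn {suc n} a τ =
    *-cong (prodFin-cong n (λ x → χ≢-injective (Fin.punchIn-injective a _ _) (τ zero) (τ (suc x))))
           (χ-inj-punchIn a (τ ∘ suc))

  sumL-filter-inj : ∀ {n} (f : (Fin n → Fin n) → Carrier) xs →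
                    sumL (map f (filter inj? xs)) ≈ sumL (map (λ σ → χ-inj σ * f σ) xs)
  sumL-filter-inj f List.[]       = refl
  sumL-filter-inj f (σ List.∷ xs) with inj? σ
  ... | yes σ-inj = begin
    sumL (map f (filter inj? (σ List.∷ xs)))  ≡⟨ ≡.cong (sumL ∘ map f) (List.filter-accept inj? σ-inj) ⟩
    f σ + sumL (map f (filter inj? xs))        ≈⟨ +-cong (sym (*-identityˡ _)) (sumL-filter-inj f xs) ⟩
    1# * f σ + rest                            ≈⟨ +-congʳ (*-congʳ (χ-inj-injective σ λ {x} {y} → σ-inj x y)) ⟨
    χ-inj σ * f σ + rest                       ∎
    where
    rest : Carrier
    rest = sumL (map (λ σ → χ-inj σ * f σ) xs)
  ... | no σ-noninj = begin
    sumL (map f (filter inj? (σ List.∷ xs)))  ≡⟨ ≡.cong (sumL ∘ map f) (List.filter-reject inj? σ-noninj) ⟩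
    sumL (map f (filter inj? xs))              ≈⟨ sumL-filter-inj f xs ⟩
    rest                                       ≈⟨ +-identityˡ rest ⟨
    0# + rest                                  ≈⟨ +-congʳ (zeroˡ (f σ)) ⟨
    0# * f σ + rest                            ≈⟨ +-congʳ (*-congʳ (χ-inj-¬injective σ λ σ-inj → σ-noninj λ x y → σ-inj)) ⟨
    χ-inj σ * f σ + rest                       ∎
    where
    rest : Carrier
    rest = sumL (map (λ σ → χ-inj σ * f σ) xs)

  per-as-sumFuns : ∀ n (A : Fin n → Fin n → Carrier) → per n A ≈ sumFuns n n (perTerm A)
  per-as-sumFuns n A = trans (sumL-filter-inj _ (allFuns n n)) (sumL-allFuns n n (perTerm A) (perTerm-cong A))

  sumFuns-χ∉ : ∀ n m (a : Fin (suc m)) (h : (Fin n → Fin (suc m)) → Carrier) → h Preserves _≗_ ⟶ _≈_ →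
               sumFuns n (suc m) (λ ρ → χ∉ a ρ * h ρ) ≈ sumFuns n m (λ τ → h (punchIn a ∘ τ))
  sumFuns-χ∉ zero    m a h h-cong = trans (*-identityˡ _) (h-cong (λ ()))
  sumFuns-χ∉ (suc n) m a h h-cong = begin
    ∑[ b < suc m ] sumFuns n (suc m) (λ ρ → (χ≢ a b * χ∉ a ρ) * h (b ∷ ρ))
      ≈⟨ sum-cong-≋ (λ b → sumFuns-cong n (suc m) (λ ρ → *-assoc (χ≢ a b) (χ∉ a ρ) (h (b ∷ ρ)))) ⟩
    ∑[ b < suc m ] sumFuns n (suc m) (λ ρ → χ≢ a b * (χ∉ a ρ * h (b ∷ ρ)))
      ≈⟨ sum-cong-≋ (λ b → sym (*-distribˡ-sumFuns n (suc m) (χ≢ a b) (λ ρ → χ∉ a ρ * h (b ∷ ρ)))) ⟩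
    ∑[ b < suc m ] (χ≢ a b * sumFuns n (suc m) (λ ρ → χ∉ a ρ * h (b ∷ ρ)))
      ≈⟨ sum-cong-≋ (λ b → *-congˡ {χ≢ a b} (sumFuns-χ∉ n m a (λ ρ → h (b ∷ ρ)) (h-cong ∘ ∷-congʳ b))) ⟩
    ∑[ b < suc m ] (χ≢ a b * sumFuns n m (λ τ → h (b ∷ punchIn a ∘ τ)))
      ≈⟨ ∑-χ≢ a (λ b → sumFuns n m (λ τ → h (b ∷ punchIn a ∘ τ))) ⟩
    ∑[ j < m ] sumFuns n m (λ τ → h (punchIn a j ∷ punchIn a ∘ τ))
      ≈⟨ sum-cong-≋ (λ j → sumFuns-cong n m (λ τ → h-cong (∘-∷ (punchIn a) j τ))) ⟩
    ∑[ j < m ] sumFuns n m (λ τ → h (punchIn a ∘ (j ∷ τ))) ∎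

  minor₀ : ∀ {n} → (Fin (suc n) → Fin (suc n) → Carrier) → Fin (suc n) → Fin n → Fin n → Carrier
  minor₀ A a r s = A (suc r) (punchIn a s)

  sumFuns-laplace : ∀ n (A : Fin (suc n) → Fin (suc n) → Carrier) →
    sumFuns (suc n) (suc n) (perTerm A) ≈ ∑[ a < suc n ] (A zero a * sumFuns n n (perTerm (minor₀ A a)))
  sumFuns-laplace n A = sum-cong-≋ λ a → begin
    sumFuns n (suc n) (λ ρ → perTerm A (a ∷ ρ))
      ≈⟨ sumFuns-cong n (suc n) (λ ρ → pull-out _ _ (A zero a) _) ⟩
    sumFuns n (suc n) (λ ρ → A zero a * (χ∉ a ρ * perTerm (A ∘ suc) ρ))
      ≈⟨ *-distribˡ-sumFuns n (suc n) (A zero a) _ ⟨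
    A zero a * sumFuns n (suc n) (λ ρ → χ∉ a ρ * perTerm (A ∘ suc) ρ)
      ≈⟨ *-congˡ (sumFuns-χ∉ n n a (perTerm (A ∘ suc)) (perTerm-cong (A ∘ suc))) ⟩
    A zero a * sumFuns n n (λ τ → perTerm (A ∘ suc) (punchIn a ∘ τ))
      ≈⟨ *-congˡ (sumFuns-cong n n (λ τ → *-congʳ (χ-inj-punchIn a τ))) ⟩
    A zero a * sumFuns n n (perTerm (minor₀ A a)) ∎
    where
    pull-out : ∀ p q x y → (p * q) * (x * y) ≈ x * (p * (q * y))
    pull-out = solve 4 (λ p q x y → (p :* q) :* (x :* y) := x :* (p :* (q :* y))) refl

  per-laplace : ∀ n (A : Fin (suc n) → Fin (suc n) → Carrier) →
                per (suc n) A ≈ ∑[ a < suc n ] (A zero a * per n (minor₀ A a))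
  per-laplace n A = begin
    per (suc n) A                                                   ≈⟨ per-as-sumFuns (suc n) A ⟩
    sumFuns (suc n) (suc n) (perTerm A)                             ≈⟨ sumFuns-laplace n A ⟩
    ∑[ a < suc n ] (A zero a * sumFuns n n (perTerm (minor₀ A a)))
      ≈⟨ sum-cong-≋ (λ a → *-congˡ {A zero a} (per-as-sumFuns n (minor₀ A a))) ⟨
    ∑[ a < suc n ] (A zero a * per n (minor₀ A a))                  ∎

  per-zero : (A : Fin 0 → Fin 0 → Carrier) → per 0 A ≈ 1#
  per-zero A = trans (per-as-sumFuns 0 A) (*-identityˡ 1#)

  per-cong : ∀ n {A B : Fin n → Fin n → Carrier} → (∀ r s → A r s ≈ B r s) → per n A ≈ per n B
  per-cong n A≈B = sumL-map-cong (λ σ → prodFin-cong n (λ r → A≈B r (σ r))) (perms n)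

module HessenbergToeplitz {c ℓ : Level} (R : CommutativeRing c ℓ) where
  open CommutativeRing R hiding (zero)
  open WithRing R
  open Sums R
  open Permanent R
  open import Relation.Binary.Reasoning.Setoid setoid
  open import Algebra.Solver.Ring.NaturalCoefficients.Default commutativeSemiring

  hessenbergEntry : Carrier → (ℕ → Carrier) → ℕ → ℕ → Carrier
  hessenbergEntry x a r       zero          = a r
  hessenbergEntry x a zero    (suc zero)    = x
  hessenbergEntry x a zero    (suc (suc s)) = 0#
  hessenbergEntry x a (suc r) (suc s)       = hessenbergEntry x a r s

  hessenberg : Carrier → (ℕ → Carrier) → ∀ n → Fin n → Fin n → Carrier
  hessenberg x a n r s = hessenbergEntry x a (toℕ r) (toℕ s)

  hessenbergEntry-≤ : ∀ x a {r s} → s ≤ r → hessenbergEntry x a r s ≡ a (r ∸ s)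
  hessenbergEntry-≤ x a z≤n       = ≡.refl
  hessenbergEntry-≤ x a (s≤s s≤r) = hessenbergEntry-≤ x a s≤r

  hessenbergEntry-super : ∀ x a r → hessenbergEntry x a r (suc r) ≡ x
  hessenbergEntry-super x a zero    = ≡.refl
  hessenbergEntry-super x a (suc r) = hessenbergEntry-super x a r

  hessenbergEntry-> : ∀ x a {r s} → suc (suc r) ≤ s → hessenbergEntry x a r s ≡ 0#
  hessenbergEntry-> x a {zero}  (s≤s (s≤s _)) = ≡.refl
  hessenbergEntry-> x a {suc r} (s≤s 2+r≤s)   = hessenbergEntry-> x a 2+r≤s

  module _ (x : Carrier) (a : ℕ → Carrier) where

    withColumn₀ : (ℕ → Carrier) → ∀ {n} → Fin n → Fin n → Carrier
    withColumn₀ c r zero    = c (toℕ r)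
    withColumn₀ c r (suc s) = hessenbergEntry x a (toℕ r) (suc (toℕ s))

    -- the first row of withColumn₀ c is (c 0, x, 0, …, 0)
    per-withColumn₀-step : ∀ m c → per (suc (suc m)) (withColumn₀ c) ≈
      c 0 * per (suc m) (hessenberg x a (suc m)) + x * per (suc m) (withColumn₀ (c ∘ suc))
    per-withColumn₀-step m c = begin
      per (suc (suc m)) (withColumn₀ c)
        ≈⟨ per-laplace (suc m) (withColumn₀ c) ⟩
      c 0 * per (suc m) (hessenberg x a (suc m)) + (x * per (suc m) (minor₀ (withColumn₀ c) (suc zero))
        + ∑[ b < m ] (0# * per (suc m) (minor₀ (withColumn₀ c) (suc (suc b)))))
        ≈⟨ +-congˡ (+-cong (*-congˡ (per-cong (suc m) minor₁)) (∑-zero m (λ b → zeroˡ _))) ⟩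
      c 0 * per (suc m) (hessenberg x a (suc m)) + (x * per (suc m) (withColumn₀ (c ∘ suc)) + 0#)
        ≈⟨ +-congˡ (+-identityʳ _) ⟩
      c 0 * per (suc m) (hessenberg x a (suc m)) + x * per (suc m) (withColumn₀ (c ∘ suc)) ∎
      where
      minor₁ : ∀ r s → minor₀ (withColumn₀ c) (suc zero) r s ≈ withColumn₀ (c ∘ suc) r s
      minor₁ r zero    = refl
      minor₁ r (suc s) = refl

    per-withColumn₀ : ∀ m c → per (suc m) (withColumn₀ c) ≈
      ∑ℕ (suc m) (λ r → pow x r * c r * per (m ∸ r) (hessenberg x a (m ∸ r)))
    per-withColumn₀ zero c = begin
      per 1 (withColumn₀ c)                                ≈⟨ per-laplace 0 (withColumn₀ c) ⟩
      c 0 * per 0 (minor₀ (withColumn₀ c) zero) + 0#       ≈⟨ +-congʳ (*-cong (sym (*-identityˡ (c 0))) per₀) ⟩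
      1# * c 0 * per 0 (hessenberg x a 0) + 0#             ∎
      where
      per₀ : per 0 (minor₀ (withColumn₀ c) zero) ≈ per 0 (hessenberg x a 0)
      per₀ = trans (per-zero (minor₀ (withColumn₀ c) zero)) (sym (per-zero (hessenberg x a 0)))
    per-withColumn₀ (suc m) c = begin
      per (suc (suc m)) (withColumn₀ c)
        ≈⟨ per-withColumn₀-step m c ⟩
      c 0 * P (suc m) + x * per (suc m) (withColumn₀ (c ∘ suc))
        ≈⟨ +-cong (*-congʳ (sym (*-identityˡ (c 0)))) (*-congˡ (per-withColumn₀ m (c ∘ suc))) ⟩
      1# * c 0 * P (suc m) + x * ∑ℕ (suc m) (λ r → pow x r * c (suc r) * P (m ∸ r))
        ≈⟨ +-congˡ (*-distribˡ-∑ℕ (suc m) x (λ r → pow x r * c (suc r) * P (m ∸ r))) ⟩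
      1# * c 0 * P (suc m) + ∑ℕ (suc m) (λ r → x * (pow x r * c (suc r) * P (m ∸ r)))
        ≈⟨ +-congˡ (∑ℕ-cong (suc m) (λ r _ → *-assoc-pow x (pow x r) (c (suc r)) (P (m ∸ r)))) ⟩
      ∑ℕ (suc (suc m)) (λ r → pow x r * c r * P (suc m ∸ r)) ∎
      where
      P : ℕ → Carrier
      P n = per n (hessenberg x a n)
      *-assoc-pow : ∀ x y c p → x * (y * c * p) ≈ x * y * c * p
      *-assoc-pow = solve 4 (λ x y c p → x :* (y :* c :* p) := x :* y :* c :* p) refl

    per-hessenberg-recurrence : ∀ m → per (suc m) (hessenberg x a (suc m)) ≈
      ∑ℕ (suc m) (λ r → pow x r * a r * per (m ∸ r) (hessenberg x a (m ∸ r)))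
    per-hessenberg-recurrence m = trans (per-cong (suc m) first-column) (per-withColumn₀ m a)
      where
      first-column : ∀ r s → hessenberg x a (suc m) r s ≈ withColumn₀ a r s
      first-column r zero    = refl
      first-column r (suc s) = refl

module Fibonacci {c ℓ : Level} (R : CommutativeRing c ℓ) (k : ℕ) where
  open CommutativeRing R hiding (zero)
  open WithRing R
  open Sums R
  open import Relation.Binary.Reasoning.Setoid setoid

  module _ (t : Fin k → Carrier) where

    tt-toℕ : ∀ j → tt k t (suc (toℕ j)) ≡ t j
    tt-toℕ j with toℕ j ℕ.<? k
    ... | yes _   = ≡.cong t (Fin.fromℕ<-toℕ j _)
    ... | no  j≮k = contradiction (Fin.toℕ<n j) j≮k

    tt-≥ : ∀ {r} → k ≤ r → tt k t (suc r) ≡ 0#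
    tt-≥ {r} k≤r with r ℕ.<? k
    ... | yes r<k = contradiction k≤r (ℕ.<⇒≱ r<k)
    ... | no  _   = ≡.refl

    Fs-suc : ∀ m → Fs k t (suc m) ≡ F k t (suc m) List.∷ Fs k t m
    Fs-suc zero    = ≡.refl
    Fs-suc (suc m) = ≡.refl

    at-Fs-≤ : ∀ {m j} → j ≤ m → at (Fs k t m) j ≡ F k t (m ∸ j)
    at-Fs-≤         z≤n       = ≡.refl
    at-Fs-≤ {suc m} (s≤s j≤m) rewrite Fs-suc m = at-Fs-≤ j≤m

    at-Fs-≥ : ∀ {m j} → m ≤ j → at (Fs k t m) j ≡ 0#
    at-Fs-≥ {zero}  {zero}  _         = ≡.refl
    at-Fs-≥ {zero}  {suc j} _         = ≡.refl
    at-Fs-≥ {suc m}         (s≤s m≤j) rewrite Fs-suc m = at-Fs-≥ m≤j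

    F-recurrence : ∀ m → F k t (suc (suc m)) ≈ ∑ℕ (suc m) (λ r → tt k t (suc r) * F k t (suc (m ∸ r)))
    F-recurrence m = begin
      F k t (suc (suc m))
        ≈⟨ sumFin-toℕ k g (λ j → *-congʳ (reflexive (≡.sym (tt-toℕ j)))) ⟩
      ∑ℕ k g
        ≈⟨ ∑ℕ-vanishing {f = g} (ℕ.m≤n+m k (suc m)) (λ r k≤r → trans (*-congʳ (reflexive (tt-≥ k≤r))) (zeroˡ _)) ⟨
      ∑ℕ (suc m ℕ.+ k) g
        ≈⟨ ∑ℕ-vanishing {f = g} (ℕ.m≤m+n (suc m) k) (λ r m<r → trans (*-congˡ (reflexive (at-Fs-≥ m<r))) (zeroʳ _)) ⟩
      ∑ℕ (suc m) g
        ≈⟨ ∑ℕ-cong (suc m) (λ r r<1+m → *-congˡ {tt k t (suc r)} (reflexive (at-Fs-≤-suc (ℕ.s≤s⁻¹ r<1+m)))) ⟩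
      ∑ℕ (suc m) (λ r → tt k t (suc r) * F k t (suc (m ∸ r))) ∎
      where
      g : ℕ → Carrier
      g r = tt k t (suc r) * at (Fs k t (suc m)) r
      at-Fs-≤-suc : ∀ {r} → r ≤ m → at (Fs k t (suc m)) r ≡ F k t (suc (m ∸ r))
      at-Fs-≤-suc r≤m = ≡.trans (at-Fs-≤ (ℕ.m≤n⇒m≤1+n r≤m)) (≡.cong (F k t) (ℕ.+-∸-assoc 1 r≤m))

module MatrixH {c ℓ : Level} (R : CommutativeRing c ℓ) where
  open CommutativeRing R hiding (zero)
  open WithRing R
  open HessenbergToeplitz R
  open import Algebra.Properties.Ring ring using (-‿distribˡ-*; -‿involutive)
  open import Relation.Binary.Reasoning.Setoid setoid
  open import Algebra.Solver.Ring.NaturalCoefficients.Default commutativeSemiring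

  pow-cancel : ∀ {x y z} → x * y * z ≈ 1# → ∀ w r → pow x r * (pow y r * w * pow z r) ≈ w
  pow-cancel xyz≈1 w zero = trans (*-identityˡ _) (trans (*-identityʳ _) (*-identityˡ w))
  pow-cancel {x} {y} {z} xyz≈1 w (suc r) = begin
    x * pow x r * (y * pow y r * w * (z * pow z r)) ≈⟨ regroup x y z (pow x r) (pow y r) (pow z r) w ⟩
    x * y * z * (pow x r * (pow y r * w * pow z r)) ≈⟨ *-cong xyz≈1 (pow-cancel xyz≈1 w r) ⟩
    1# * w                                          ≈⟨ *-identityˡ w ⟩
    w                                               ∎
    where
    regroup : ∀ x y z x' y' z' w → x * x' * (y * y' * w * (z * z')) ≈ x * y * z * (x' * (y' * w * z'))
    regroup = solve 7 (λ x y z x' y' z' w →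
      x :* x' :* (y :* y' :* w :* (z :* z')) := x :* y :* z :* (x' :* (y' :* w :* z'))) refl

  -i*v*i*u≈1 : ∀ {i v u} → i * i ≈ - 1# → v * u ≈ 1# → (- i) * v * i * u ≈ 1#
  -i*v*i*u≈1 {i} {v} {u} i²≈-1 vu≈1 = begin
    (- i) * v * i * u    ≈⟨ regroup (- i) v i u ⟩
    (- i) * i * (v * u)  ≈⟨ *-cong (trans (sym (-‿distribˡ-* i i)) (-‿cong i²≈-1)) vu≈1 ⟩
    - - 1# * 1#          ≈⟨ trans (*-identityʳ _) (-‿involutive 1#) ⟩
    1#                   ∎
    where
    regroup : ∀ a v i u → a * v * i * u ≈ a * i * (v * u)
    regroup = solve 4 (λ a v i u → a :* v :* i :* u := a :* i :* (v :* u)) refl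

  module _ (k : ℕ) (t : Fin k → Carrier) (i u : Carrier) where
    open Fibonacci R k using (tt-≥)

    superdiagonal : Carrier
    superdiagonal = (- i) * tt k t 2

    diagonals : ℕ → Carrier
    diagonals d = pow i d * tt k t (suc d) * pow u d

    H-hessenberg : ∀ n (r s : Fin n) → H k t i u n r s ≈ hessenberg superdiagonal diagonals n r s
    H-hessenberg n r s with toℕ s ℕ.≟ suc (toℕ r)
    ... | yes s≡1+r = reflexive (≡.sym (≡.trans (≡.cong (hessenbergEntry superdiagonal diagonals (toℕ r)) s≡1+r)
                                                (hessenbergEntry-super superdiagonal diagonals (toℕ r))))
    ... | no s≢1+r with toℕ s ℕ.≤? toℕ r
    ...   | no s≰r = reflexive (≡.sym (hessenbergEntry-> superdiagonal diagonals
                                        (ℕ.≤∧≢⇒< (ℕ.≰⇒> s≰r) (s≢1+r ∘ ≡.sym))))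
    ...   | yes s≤r with (toℕ r ∸ toℕ s) ℕ.<? k
    ...     | yes _  = reflexive (≡.sym (hessenbergEntry-≤ superdiagonal diagonals s≤r))
    ...     | no d≮k = trans (sym beyond-k) (reflexive (≡.sym (hessenbergEntry-≤ superdiagonal diagonals s≤r)))
      where
      beyond-k : diagonals (toℕ r ∸ toℕ s) ≈ 0#
      beyond-k = trans (*-congʳ (trans (*-congˡ (reflexive (tt-≥ t (ℕ.≮⇒≥ d≮k)))) (zeroʳ _))) (zeroˡ _)

    diagonal-coefficient : i * i ≈ - 1# → tt k t 2 * u ≈ 1# →
                           ∀ r → pow superdiagonal r * diagonals r ≈ tt k t (suc r)
    diagonal-coefficient i²≈-1 t₂u≈1 r = pow-cancel (-i*v*i*u≈1 i²≈-1 t₂u≈1) (tt k t (suc r)) r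

theorem3p2 : ∀ {c ℓ : Level} (R : CommutativeRing c ℓ) →
  let open CommutativeRing R
      open WithRing R
  in (k n : ℕ) → 2 ≤ k → 1 ≤ n →
     (t : Fin k → Carrier) (i u : Carrier) →
     i * i ≈ - 1# → tt k t 2 * u ≈ 1# →
     per n (H k t i u n) ≈ F k t (suc n)
theorem3p2 R k n _ _ t i u i²≈-1 t₂u≈1 = begin
  per n (H k t i u n)                    ≈⟨ per-cong n (H-hessenberg k t i u n) ⟩
  per n (hessenberg x a n)               ≈⟨ recurrence-unique w P (F k t ∘ suc) (per-zero (hessenberg x a 0)) recP (F-recurrence t) n ⟩
  F k t (suc n)                          ∎
  where
  open CommutativeRing R hiding (zero)
  open WithRing R
  open Sums R
  open Permanent R
  open HessenbergToeplitz R
  open Fibonacci R k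
  open MatrixH R
  open import Relation.Binary.Reasoning.Setoid setoid
  x : Carrier
  x = superdiagonal k t i u
  a : ℕ → Carrier
  a = diagonals k t i u
  w : ℕ → Carrier
  w r = tt k t (suc r)
  P : ℕ → Carrier
  P m = per m (hessenberg x a m)
  recP : ∀ m → P (suc m) ≈ ∑ℕ (suc m) (λ r → w r * P (m ∸ r))
  recP m = trans (per-hessenberg-recurrence x a m)
                 (∑ℕ-cong (suc m) (λ r _ → *-congʳ {P (m ∸ r)} (diagonal-coefficient k t i u i²≈-1 t₂u≈1 r)))
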